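{- Let $m\ge2$ be an integer and let $(A_n(z))_{n\ge0}$ be polynomials with $\deg A_n=n$ such that $[z^{n-k}]A_n(z)=[z^{n+1-k}]A_{n+1}(z)$ for all $n\ge0$ and $0\le k\le n/m$. Let $(B_n(z))_{n\ge0}$ be any sequence of polynomials, and define the Laurent polynomials $F_n(z)=\sum_{\ell=0}^n A_\ell(z)B_{n-\ell}(z^{ -1})$. Then $[z^{n-k}]F_n(z)=[z^{n+1-k}]F_{n+1}(z)$ for all $n\ge0$ and $0\le k\le n/m$.
   Context: $[z^k]$ denotes the coefficient of $z^k$ in a Laurent polynomial. -}

module Defs where

open import Level using (Level; _⊔_)
open import Data.Nat using (ℕ; zero; suc; _∸_)
open import Data.Integer using (ℤ; +_; -[1+_]) renaming (_-_ to _-ℤ_)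
open import Data.List using (List; []; _∷_; length)
open import Relation.Binary.PropositionalEquality using (_≡_)
open import Relation.Nullary using (¬_)
open import Data.Product using (_×_)
open import Algebra.Bundles using (CommutativeRing)

module _ {c ℓ : Level} (R : CommutativeRing c ℓ) where
  open CommutativeRing R

  -- A polynomial over R, given by its coefficient list [a₀, a₁, …] (constant term first).
  Poly : Set c
  Poly = List Carrier

  coeff : Poly → ℕ → Carrier
  coeff []       _       = 0#
  coeff (a ∷ p)  zero    = a
  coeff (a ∷ p)  (suc i) = coeff p i

  coeffℤ : Poly → ℤ → Carrier
  coeffℤ p (+ i)    = coeff p i
  coeffℤ p -[1+ _ ] = 0#

  sumTo : ℕ → (ℕ → Carrier) → Carrier
  sumTo zero    f = 0#
  sumTo (suc n) f = sumTo n f + f n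

  HasDegree : Poly → ℕ → Set ℓ
  HasDegree p n = (length p ≡ suc n) × (¬ (coeff p n ≈ 0#))

  -- [z^j] ( a(z) · b(z⁻¹) ) = Σ_i [z^i]a · [z^(i-j)]b   (j ∈ ℤ)
  coeffMixed : Poly → Poly → ℤ → Carrier
  coeffMixed a b j = sumTo (length a) (λ i → coeff a i * coeffℤ b ((+ i) -ℤ j))

  coeffF : (ℕ → Poly) → (ℕ → Poly) → ℕ → ℤ → Carrier
  coeffF A B n j = sumTo (suc n) (λ l → coeffMixed (A l) (B (n ∸ l)) j)

-- The coefficient of z^(n-k) in A_ℓ(z) B_(n-ℓ)(z⁻¹) is Σ_i [z^i]A_ℓ · [z^(i-n+k)]B_(n-ℓ).
-- Passing from F_n to F_(n+1) and shifting ℓ ↦ ℓ+1 pairs this with the term of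
-- A_(ℓ+1)(z) B_(n-ℓ)(z⁻¹), with the same B; the new term ℓ = 0 vanishes because A_0 is
-- constant. Within a pair only the indices i ≥ n-k contribute, and for those the gap
-- ℓ - i is at most k - (n-ℓ), which forces m(ℓ-i) ≤ ℓ; so [z^i]A_ℓ = [z^(i+1)]A_(ℓ+1)
-- by hypothesis and the paired sums agree term by term.
module Submission where

open import Defs
open import Level using (Level)
open import Data.Nat using (ℕ; zero; suc; _+_; _*_; _∸_; _≤_; _<_; z≤n; s≤s; _≤?_)
open import Data.Nat.Properties
  using ( ≤-refl; ≤-reflexive; ≤-trans; ≤-pred; ≰⇒>; m≤n⇒m≤1+n; module ≤-Reasoning
        ; +-assoc; +-comm; +-monoʳ-≤; +-cancelˡ-≤; +-cancelʳ-≤; *-monoʳ-≤; *-distribˡ-+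
        ; m≤n*m; m≤n+m∸n; m+[n∸m]≡n; m∸[m∸n]≡n; m∸n≤m; +-∸-assoc )
open import Data.Integer using (ℤ; +_) renaming (_-_ to _-ℤ_)
open import Data.Integer.Properties using ([1+m]⊖[1+n]≡m⊖n; [+m]-[+n]≡m⊖n)
open import Data.List using (length)
open import Data.Product using (proj₁)
open import Relation.Nullary using (yes; no)
open import Relation.Binary.PropositionalEquality as ≡ using (_≡_; cong)
open import Algebra.Bundles using (CommutativeRing)
import Relation.Binary.Reasoning.Setoid as SetoidReasoning

+[1+m]-+[1+n]≡+m-+n : ∀ m n → (+ suc m) -ℤ (+ suc n) ≡ (+ m) -ℤ (+ n)
+[1+m]-+[1+n]≡+m-+n m n = ≡.trans ([1+m]⊖[1+n]≡m⊖n m n) (≡.sym ([+m]-[+n]≡m⊖n m n))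

m*[l∸i]≤l : ∀ m {n k l i} → suc m * k ≤ n → n ∸ k ≤ i → i ≤ l → l ≤ n →
            suc m * (l ∸ i) ≤ l
m*[l∸i]≤l m {n} {k} {l} {i} mk≤n n∸k≤i i≤l l≤n = +-cancelʳ-≤ e _ _ (begin
  suc m * d + e         ≤⟨ +-monoʳ-≤ (suc m * d) (m≤n*m e (suc m)) ⟩
  suc m * d + suc m * e ≡⟨ *-distribˡ-+ (suc m) d e ⟨
  suc m * (d + e)       ≤⟨ *-monoʳ-≤ (suc m) d+e≤k ⟩
  suc m * k             ≤⟨ mk≤n ⟩
  n                     ≡⟨ l+e≡n ⟨
  l + e                 ∎)
  where
  open ≤-Reasoning
  d = l ∸ i
  e = n ∸ l
  l+e≡n : l + e ≡ n
  l+e≡n = m+[n∸m]≡n l≤n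
  d+e≤k : d + e ≤ k
  d+e≤k = +-cancelˡ-≤ i _ _ (begin
    i + (d + e) ≡⟨ +-assoc i d e ⟨
    i + d + e   ≡⟨ cong (_+ e) (m+[n∸m]≡n i≤l) ⟩
    l + e       ≡⟨ l+e≡n ⟩
    n           ≤⟨ m≤n+m∸n n k ⟩
    k + (n ∸ k) ≤⟨ +-monoʳ-≤ k n∸k≤i ⟩
    k + i       ≡⟨ +-comm k i ⟩
    i + k       ∎)

module _ {c ℓ : Level} (R : CommutativeRing c ℓ) where
  open CommutativeRing R renaming (_+_ to _⊕_; _*_ to _⊛_)
  open SetoidReasoning setoid

  sumTo-cong : ∀ N {f g : ℕ → Carrier} → (∀ i → i < N → f i ≈ g i) →
               sumTo R N f ≈ sumTo R N g
  sumTo-cong zero    f≈g = refl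
  sumTo-cong (suc N) f≈g =
    +-cong (sumTo-cong N (λ i i<N → f≈g i (m≤n⇒m≤1+n i<N))) (f≈g N ≤-refl)

  sumTo-zero : ∀ N {f : ℕ → Carrier} → (∀ i → i < N → f i ≈ 0#) → sumTo R N f ≈ 0#
  sumTo-zero zero    f≈0 = refl
  sumTo-zero (suc N) f≈0 = begin
    sumTo R N _ ⊕ _ ≈⟨ +-cong (sumTo-zero N (λ i i<N → f≈0 i (m≤n⇒m≤1+n i<N))) (f≈0 N ≤-refl) ⟩
    0# ⊕ 0#         ≈⟨ +-identityˡ 0# ⟩
    0#              ∎

  sumTo-suc-shift : ∀ N {f : ℕ → Carrier} → f 0 ≈ 0# →
                    sumTo R (suc N) f ≈ sumTo R N (λ i → f (suc i))
  sumTo-suc-shift zero    f0≈0 = trans (+-identityˡ _) f0≈0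
  sumTo-suc-shift (suc N) f0≈0 = +-congʳ (sumTo-suc-shift N f0≈0)

  coeffℤ-negative : ∀ p {i j} → i < j → coeffℤ R p ((+ i) -ℤ (+ j)) ≡ 0#
  coeffℤ-negative p {zero}  {suc j} _         = ≡.refl
  coeffℤ-negative p {suc i} {suc j} (s≤s i<j) =
    ≡.trans (cong (coeffℤ R p) (+[1+m]-+[1+n]≡+m-+n i j)) (coeffℤ-negative p i<j)

  mixedTerm : Poly R → Poly R → ℤ → ℕ → Carrier
  mixedTerm a b j i = coeff R a i ⊛ coeffℤ R b ((+ i) -ℤ j)

  mixedTerm-negative : ∀ a b {i j} → i < j → mixedTerm a b (+ j) i ≈ 0#
  mixedTerm-negative a b i<j =
    trans (*-congˡ (reflexive (coeffℤ-negative b i<j))) (zeroʳ _)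

  coeffMixed-length : ∀ a b j {N} → length a ≡ N →
                      coeffMixed R a b j ≡ sumTo R N (mixedTerm a b j)
  coeffMixed-length a b j = cong (λ N → sumTo R N (mixedTerm a b j))

  coeffMixed-vanishes : ∀ a b {j} → length a ≤ j → coeffMixed R a b (+ j) ≈ 0#
  coeffMixed-vanishes a b len≤j =
    sumTo-zero (length a) (λ i i<len → mixedTerm-negative a b (≤-trans i<len len≤j))

  coeffMixed-shift : ∀ a a' b {l x} → length a ≡ suc l → length a' ≡ suc (suc l) →
                     (∀ i → x ≤ i → i ≤ l → coeff R a i ≈ coeff R a' (suc i)) →
                     coeffMixed R a b (+ x) ≈ coeffMixed R a' b (+ suc x)
  coeffMixed-shift a a' b {l} {x} len-a len-a' high = begin
    coeffMixed R a b (+ x)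
      ≡⟨ coeffMixed-length a b (+ x) len-a ⟩
    sumTo R (suc l) (mixedTerm a b (+ x))
      ≈⟨ sumTo-cong (suc l) (λ i i<1+l → termwise i (≤-pred i<1+l)) ⟩
    sumTo R (suc l) (λ i → mixedTerm a' b (+ suc x) (suc i))
      ≈⟨ sumTo-suc-shift (suc l) (mixedTerm-negative a' b {0} {suc x} (s≤s z≤n)) ⟨
    sumTo R (suc (suc l)) (mixedTerm a' b (+ suc x))
      ≡⟨ coeffMixed-length a' b (+ suc x) len-a' ⟨
    coeffMixed R a' b (+ suc x) ∎
    where
    termwise : ∀ i → i ≤ l → mixedTerm a b (+ x) i ≈ mixedTerm a' b (+ suc x) (suc i)
    termwise i i≤l
      rewrite +[1+m]-+[1+n]≡+m-+n i x with x ≤? i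
    ... | yes x≤i = *-congʳ (high i x≤i i≤l)
    ... | no  x≰i rewrite coeffℤ-negative b (≰⇒> x≰i) = trans (zeroʳ _) (sym (zeroʳ _))

  coeffF-shift : ∀ (A B : ℕ → Poly R) → (∀ l → length (A l) ≡ suc l) → ∀ n x →
                 (∀ l → l ≤ n → ∀ i → x ≤ i → i ≤ l →
                    coeff R (A l) i ≈ coeff R (A (suc l)) (suc i)) →
                 coeffF R A B n (+ x) ≈ coeffF R A B (suc n) (+ suc x)
  coeffF-shift A B len n x high = begin
    coeffF R A B n (+ x)
      ≈⟨ sumTo-cong (suc n) (λ l l<1+n →
           coeffMixed-shift (A l) (A (suc l)) (B (n ∸ l)) (len l) (len (suc l))
             (high l (≤-pred l<1+n))) ⟩
    sumTo R (suc n) (λ l → coeffMixed R (A (suc l)) (B (n ∸ l)) (+ suc x))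
      ≈⟨ sumTo-suc-shift (suc n) A₀-term≈0 ⟨
    coeffF R A B (suc n) (+ suc x) ∎
    where
    A₀-term≈0 : coeffMixed R (A 0) (B (suc n)) (+ suc x) ≈ 0#
    A₀-term≈0 = coeffMixed-vanishes (A 0) (B (suc n)) (≤-trans (≤-reflexive (len 0)) (s≤s z≤n))

  high-coeff-reindex : ∀ (A : ℕ → Poly R) m →
    (∀ n k → m * k ≤ n → coeff R (A n) (n ∸ k) ≈ coeff R (A (suc n)) (suc n ∸ k)) →
    ∀ l i → i ≤ l → m * (l ∸ i) ≤ l → coeff R (A l) i ≈ coeff R (A (suc l)) (suc i)
  high-coeff-reindex A m stable l i i≤l bound = begin
    coeff R (A l) i                        ≡⟨ cong (coeff R (A l)) (m∸[m∸n]≡n i≤l) ⟨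
    coeff R (A l) (l ∸ (l ∸ i))            ≈⟨ stable l (l ∸ i) bound ⟩
    coeff R (A (suc l)) (suc l ∸ (l ∸ i))  ≡⟨ cong (coeff R (A (suc l))) 1+l∸[l∸i]≡1+i ⟩
    coeff R (A (suc l)) (suc i)            ∎
    where
    1+l∸[l∸i]≡1+i : suc l ∸ (l ∸ i) ≡ suc i
    1+l∸[l∸i]≡1+i = ≡.trans (+-∸-assoc 1 (m∸n≤m l i)) (cong suc (m∸[m∸n]≡n i≤l))

lemma9 : {c ℓ : Level} (R : CommutativeRing c ℓ) (m : ℕ) → 2 ≤ m →
    (A B : ℕ → Poly R) →
    (∀ n → HasDegree R (A n) n) →
    (∀ n k → m * k ≤ n →
    CommutativeRing._≈_ R (coeff R (A n) (n ∸ k)) (coeff R (A (suc n)) (suc n ∸ k))) →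
    ∀ n k → m * k ≤ n →
    CommutativeRing._≈_ R (coeffF R A B n (+ (n ∸ k))) (coeffF R A B (suc n) (+ (suc n ∸ k)))
lemma9 R (suc m) _ A B deg stable n k mk≤n
  rewrite +-∸-assoc 1 (≤-trans (m≤n*m k (suc m)) mk≤n) =
  coeffF-shift R A B (λ l → proj₁ (deg l)) n (n ∸ k) λ l l≤n i n∸k≤i i≤l →
    high-coeff-reindex R A (suc m) stable l i i≤l (m*[l∸i]≤l m mk≤n n∸k≤i i≤l l≤n)
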